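{- Every L-consistent set $\Psi\subseteq Fm$ is satisfiable, i.e. there is an interpretation $(\mathcal{M},\gamma)$ with $(\mathcal{M},\gamma)\vDash\psi$ for all $\psi\in\Psi$.
   Context: Let $V=\{x_0,x_1,\dots\}$ be an infinite set of propositional variables; $Fm$ is generated from $V$ by $\bot$, binary $\rightarrow,\vee,\wedge$ and unary $\square$. Abbreviations: $\neg\varphi:=\varphi\rightarrow\bot$, $\varphi\equiv\psi:=\square(\varphi\rightarrow\psi)\wedge\square(\psi\rightarrow\varphi)$; $\chi[x:=\varphi]$ is substitution of $\varphi$ for $x$ in $\chi$. The logic L: axioms are all formulas of the forms (i) substitution instances (variables replaced by arbitrary formulas of $Fm$) of intuitionistic propositional tautologies; (ii) $\square\varphi\rightarrow\varphi$; (iii) $\square(\varphi\rightarrow\psi)\rightarrow(\square(\psi\rightarrow\chi)\rightarrow\square(\varphi\rightarrow\chi))$; (iv) $\square(\varphi\vee\psi)\rightarrow(\square\varphi\vee\square\psi)$; rules are Modus Ponens and Axiom Necessitation (from an axiom $\varphi$ of form (i)–(iv) infer $\square\varphi$); additionally all formulas $\varphi\vee\neg\varphi$ and $(\varphi\equiv\psi)\rightarrow(\chi[x:=\varphi]\equiv\chi[x:=\psi])$ are theorems (usable in derivations, not subject to Axiom Necessitation). A set $\Psi$ is L-consistent if $\bot$ is not derivable from $\Psi$ in L. Semantics: a Heyting algebra $(M,f_\top,f_\bot,f_\vee,f_\wedge,f_\rightarrow)$ is a bounded lattice (top $f_\top$, bottom $f_\bot$, order $\le$) with $f_\rightarrow(m,m')$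 the greatest $m''$ with $f_\wedge(m,m'')\le m'$; a filter is a non-empty upward closed $F\subseteq M$ closed under $f_\wedge$ with $f_\bot\notin F$; an ultrafilter is a maximal filter. A model $\mathcal{M}=(M,\mathit{TRUE},f_\top,f_\bot,f_\rightarrow,f_\vee,f_\wedge,f_\square)$ is a Heyting algebra with an ultrafilter $\mathit{TRUE}$ and unary $f_\square$ such that for all $m,m',m''$: (1) $f_\square(m)\le m$; (2) $f_\square(f_\rightarrow(m,m'))\le f_\rightarrow(f_\square(f_\rightarrow(m',m'')),f_\square(f_\rightarrow(m,m'')))$; (3) $f_\square(f_\vee(m,m'))\le f_\vee(f_\square(m),f_\square(m'))$; (4) $f_\square(m)\in\mathit{TRUE}\iff m=f_\top$. An assignment $\gamma:V\to M$ extends homomorphically to $Fm$ ($\gamma(\bot)=f_\bot$, $\gamma(\square\varphi)=f_\square(\gamma(\varphi))$, $\gamma(\varphi*\psi)=f_*(\gamma(\varphi),\gamma(\psi))$). An interpretation is a pair $(\mathcal{M},\gamma)$; $(\mathcal{M},\gamma)\vDash\varphi$ iff $\gamma(\varphi)\in\mathit{TRUE}$. -}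

module Defs where

open import Level using (0ℓ)
open import Data.Nat using (ℕ; _≟_)
open import Data.Product using (Σ; _×_)
open import Data.Empty using (⊥)
open import Relation.Nullary using (¬_; yes; no)
open import Relation.Binary.Lattice.Bundles using (HeytingAlgebra)

infixr 5 _⇒_
infixr 6 _∨'_
infixr 7 _∧'_

data Fm : Set where
  var : ℕ → Fm
  ⊥'  : Fm
  _⇒_ : Fm → Fm → Fm
  _∨'_ : Fm → Fm → Fm
  _∧'_ : Fm → Fm → Fm
  □   : Fm → Fm

¬' : Fm → Fm
¬' φ = φ ⇒ ⊥'

_≡'_ : Fm → Fm → Fm
φ ≡' ψ = □ (φ ⇒ ψ) ∧' □ (ψ ⇒ φ)

_[_≔_] : Fm → ℕ → Fm → Fm
var y [ x ≔ φ ] with y ≟ x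
... | yes _ = φ
... | no  _ = var y
⊥'      [ x ≔ φ ] = ⊥'
(a ⇒ b) [ x ≔ φ ] = (a [ x ≔ φ ]) ⇒ (b [ x ≔ φ ])
(a ∨' b) [ x ≔ φ ] = (a [ x ≔ φ ]) ∨' (b [ x ≔ φ ])
(a ∧' b) [ x ≔ φ ] = (a [ x ≔ φ ]) ∧' (b [ x ≔ φ ])
□ a     [ x ≔ φ ] = □ (a [ x ≔ φ ])

data PFm : Set where
  pvar : ℕ → PFm
  p⊥   : PFm
  _p⇒_ : PFm → PFm → PFm
  _p∨_ : PFm → PFm → PFm
  _p∧_ : PFm → PFm → PFm

-- IPC-theorems ("intuitionistic propositional tautologies")
data IPC : PFm → Set where
  ax-K   : ∀ A B → IPC (A p⇒ (B p⇒ A))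
  ax-S   : ∀ A B C → IPC ((A p⇒ (B p⇒ C)) p⇒ ((A p⇒ B) p⇒ (A p⇒ C)))
  ax-∧I  : ∀ A B → IPC (A p⇒ (B p⇒ (A p∧ B)))
  ax-∧E₁ : ∀ A B → IPC ((A p∧ B) p⇒ A)
  ax-∧E₂ : ∀ A B → IPC ((A p∧ B) p⇒ B)
  ax-∨I₁ : ∀ A B → IPC (A p⇒ (A p∨ B))
  ax-∨I₂ : ∀ A B → IPC (B p⇒ (A p∨ B))
  ax-∨E  : ∀ A B C → IPC ((A p⇒ C) p⇒ ((B p⇒ C) p⇒ ((A p∨ B) p⇒ C)))
  ax-EFQ : ∀ A → IPC (p⊥ p⇒ A)
  ipc-mp : ∀ {A B} → IPC (A p⇒ B) → IPC A → IPC B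

inst : (ℕ → Fm) → PFm → Fm
inst σ (pvar n)  = σ n
inst σ p⊥        = ⊥'
inst σ (A p⇒ B)  = inst σ A ⇒ inst σ B
inst σ (A p∨ B)  = inst σ A ∨' inst σ B
inst σ (A p∧ B)  = inst σ A ∧' inst σ B

data Axiom : Fm → Set where
  ax-int : ∀ (σ : ℕ → Fm) (A : PFm) → IPC A → Axiom (inst σ A)
  ax-T   : ∀ φ → Axiom (□ φ ⇒ φ)
  ax-tr  : ∀ φ ψ χ → Axiom (□ (φ ⇒ ψ) ⇒ (□ (ψ ⇒ χ) ⇒ □ (φ ⇒ χ)))
  ax-dis : ∀ φ ψ → Axiom (□ (φ ∨' ψ) ⇒ (□ φ ∨' □ ψ))

data _⊢_ (Ψ : Fm → Set) : Fm → Set where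
  hyp  : ∀ {φ} → Ψ φ → Ψ ⊢ φ
  ax   : ∀ {φ} → Axiom φ → Ψ ⊢ φ
  nec  : ∀ {φ} → Axiom φ → Ψ ⊢ □ φ
  tnd  : ∀ φ → Ψ ⊢ (φ ∨' ¬' φ)
  subst-thm : ∀ φ ψ χ x →
    Ψ ⊢ ((φ ≡' ψ) ⇒ ((χ [ x ≔ φ ]) ≡' (χ [ x ≔ ψ ])))
  mp   : ∀ {φ ψ} → Ψ ⊢ (φ ⇒ ψ) → Ψ ⊢ φ → Ψ ⊢ ψ

L-consistent : (Fm → Set) → Set
L-consistent Ψ = ¬ (Ψ ⊢ ⊥')

-- Semantics.  Heyting algebras are the stdlib (setoid-based) ones.

module _ (H : HeytingAlgebra 0ℓ 0ℓ 0ℓ) where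
  open HeytingAlgebra H renaming (⊤ to f⊤; ⊥ to f⊥; _∧_ to _f∧_)

  record IsFilter (F : Carrier → Set) : Set where
    field
      nonempty   : Σ Carrier F
      upward     : ∀ {m m'} → F m → m ≤ m' → F m'
      meet       : ∀ {m m'} → F m → F m' → F (m f∧ m')
      bot∉       : ¬ F f⊥

  record IsUltrafilter (F : Carrier → Set) : Set₁ where
    field
      isFilter : IsFilter F
      maximal  : ∀ (G : Carrier → Set) → IsFilter G →
                 (∀ m → F m → G m) → (∀ m → G m → F m)

record Model : Set₁ where
  field
    HA : HeytingAlgebra 0ℓ 0ℓ 0ℓ
  open HeytingAlgebra HA public
  field
    TRUE          : Carrier → Set
    TRUE-ultra    : IsUltrafilter HA TRUE
    f□            : Carrier → Carrier
    f□-cong       : ∀ {m m'} → m ≈ m' → f□ m ≈ f□ m'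
    cond1         : ∀ m → f□ m ≤ m
    cond2         : ∀ m m' m'' →
      f□ (m ⇨ m') ≤ (f□ (m' ⇨ m'') ⇨ f□ (m ⇨ m''))
    cond3         : ∀ m m' → f□ (m ∨ m') ≤ (f□ m ∨ f□ m')
    cond4         : ∀ m → (TRUE (f□ m) → m ≈ ⊤) × (m ≈ ⊤ → TRUE (f□ m))

⟦_⟧ : (𝓜 : Model) → Fm → (ℕ → Model.Carrier 𝓜) → Model.Carrier 𝓜
⟦ 𝓜 ⟧ (var n) γ = γ n
⟦ 𝓜 ⟧ ⊥'      γ = Model.⊥ 𝓜
⟦ 𝓜 ⟧ (a ⇒ b) γ = Model._⇨_ 𝓜 (⟦ 𝓜 ⟧ a γ) (⟦ 𝓜 ⟧ b γ)
⟦ 𝓜 ⟧ (a ∨' b) γ = Model._∨_ 𝓜 (⟦ 𝓜 ⟧ a γ) (⟦ 𝓜 ⟧ b γ)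
⟦ 𝓜 ⟧ (a ∧' b) γ = Model._∧_ 𝓜 (⟦ 𝓜 ⟧ a γ) (⟦ 𝓜 ⟧ b γ)
⟦ 𝓜 ⟧ (□ a)   γ = Model.f□ 𝓜 (⟦ 𝓜 ⟧ a γ)

_,_⊨_ : (𝓜 : Model) → (ℕ → Model.Carrier 𝓜) → Fm → Set
𝓜 , γ ⊨ φ = Model.TRUE 𝓜 (⟦ 𝓜 ⟧ φ γ)

Satisfiable : (Fm → Set) → Set₁
Satisfiable Ψ = Σ Model λ 𝓜 → Σ (ℕ → Model.Carrier 𝓜) λ γ → ∀ ψ → Ψ ψ → 𝓜 , γ ⊨ ψ

-- By Lindenbaum's lemma (using excluded middle and an injective
-- coding of formulas by numbers) Ψ extends to a consistent and complete theory Γ.  Formulas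
-- themselves then form a Heyting algebra with a ≈ b iff Γ ⊢ a ≡ b and a ≤ b iff Γ ⊢ □(a → b),
-- the Γ-theorems form an ultrafilter, □ interprets itself, and the identity assignment makes
-- exactly the Γ-theorems true.  The delicate point is that L only necessitates axioms: every
-- lattice law of ≤ is obtained by transporting a necessitated intuitionistic tautology along a
-- provable ≡, which the substitution theorem makes possible.
module Submission where

open import Defs
open import Level using (0ℓ)
open import Axiom.ExcludedMiddle using (ExcludedMiddle)
open import Data.Empty using (⊥-elim)
open import Data.Nat using (ℕ; zero; suc; _+_; _≤_; _⊔_; _≟_; _≤′_; ≤′-reflexive; ≤′-step)
open import Data.Nat.Properties using (≤-refl; n≮n; m≤m⊔n; m≤n⊔m; m⊔n≤o⇒m≤o; m⊔n≤o⇒n≤o; ≤⇒≤′; +-suc; +-identityʳ)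
open import Data.Nat.Binary using (ℕᵇ; zero; 2[1+_]; 1+[2_]; toℕ)
open import Data.Nat.Binary.Properties using (toℕ-injective)
open import Data.List using (List; []; _∷_)
open import Data.List.Properties using (∷-injectiveˡ)
open import Data.List.Membership.Propositional using (_∈_)
open import Data.List.Relation.Unary.Any using (here; there)
open import Data.Product using (Σ; _×_; _,_; swap)
open import Data.Sum using (_⊎_; inj₁; inj₂)
open import Relation.Nullary using (yes; no)
open import Relation.Unary using (_⊆_; _⊆′_; _∪_; ｛_｝; ⋃)
open import Relation.Binary.PropositionalEquality
  using (_≡_; refl; sym; trans; cong; cong₂; subst; subst₂; module ≡-Reasoning)
open import Relation.Binary.Lattice.Bundles using (HeytingAlgebra)

-- Intuitionistic logic

infix 3 _⊢ᵢ_
infixl 5 _·_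

data _⊢ᵢ_ (Γ : List PFm) : PFm → Set where
  assume  : ∀ {A} → A ∈ Γ → Γ ⊢ᵢ A
  theorem : ∀ {A} → IPC A → Γ ⊢ᵢ A
  _·_     : ∀ {A B} → Γ ⊢ᵢ A p⇒ B → Γ ⊢ᵢ A → Γ ⊢ᵢ B

ipc-id : ∀ A → IPC (A p⇒ A)
ipc-id A = ipc-mp (ipc-mp (ax-S A (A p⇒ A) A) (ax-K A (A p⇒ A))) (ax-K A A)

⇒-intro : ∀ {Γ A B} → A ∷ Γ ⊢ᵢ B → Γ ⊢ᵢ A p⇒ B
⇒-intro (assume (here refl))  = theorem (ipc-id _)
⇒-intro (assume (there A∈Γ)) = theorem (ax-K _ _) · assume A∈Γ
⇒-intro (theorem p)           = theorem (ax-K _ _) · theorem p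
⇒-intro (f · x)               = theorem (ax-S _ _ _) · ⇒-intro f · ⇒-intro x

closed : ∀ {A} → [] ⊢ᵢ A → IPC A
closed (assume ())
closed (theorem p) = p
closed (f · x)     = ipc-mp (closed f) (closed x)

module _ {Γ : List PFm} {A B : PFm} where
  ∧I : Γ ⊢ᵢ A → Γ ⊢ᵢ B → Γ ⊢ᵢ A p∧ B
  ∧I x y = theorem (ax-∧I _ _) · x · y

  ∧E₁ : Γ ⊢ᵢ A p∧ B → Γ ⊢ᵢ A
  ∧E₁ p = theorem (ax-∧E₁ _ _) · p

  ∧E₂ : Γ ⊢ᵢ A p∧ B → Γ ⊢ᵢ B
  ∧E₂ p = theorem (ax-∧E₂ _ _) · p

  ∨I₁ : Γ ⊢ᵢ A → Γ ⊢ᵢ A p∨ B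
  ∨I₁ p = theorem (ax-∨I₁ _ _) · p

  ∨I₂ : Γ ⊢ᵢ B → Γ ⊢ᵢ A p∨ B
  ∨I₂ p = theorem (ax-∨I₂ _ _) · p

  ∨E : ∀ {C} → Γ ⊢ᵢ A p⇒ C → Γ ⊢ᵢ B p⇒ C → Γ ⊢ᵢ A p∨ B → Γ ⊢ᵢ C
  ∨E f g x = theorem (ax-∨E _ _ _) · f · g · x

#0 : ∀ {A Γ} → A ∷ Γ ⊢ᵢ A
#0 = assume (here refl)

#1 : ∀ {A B Γ} → B ∷ A ∷ Γ ⊢ᵢ A
#1 = assume (there (here refl))

#2 : ∀ {A B C Γ} → C ∷ B ∷ A ∷ Γ ⊢ᵢ A
#2 = assume (there (there (here refl)))

pA pB pC p⊤ : PFm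
pA = pvar 0
pB = pvar 1
pC = pvar 2
p⊤ = p⊥ p⇒ p⊥

_⇔ᵢ_ : PFm → PFm → Set
A ⇔ᵢ B = IPC (A p⇒ B) × IPC (B p⇒ A)

⊤-intro : IPC (pA p⇒ p⊤)
⊤-intro = ipc-mp (ax-K p⊤ pA) (ax-EFQ p⊥)

non-contradiction : IPC ((pA p∧ (pA p⇒ p⊥)) p⇒ p⊥)
non-contradiction = closed (⇒-intro (∧E₂ #0 · ∧E₁ #0))

⊤⇒-identity : (p⊤ p⇒ pA) ⇔ᵢ pA
⊤⇒-identity = closed (⇒-intro (#0 · theorem (ax-EFQ p⊥))) , ax-K pA p⊤

⊤∧-identity : (p⊤ p∧ pA) ⇔ᵢ pA
⊤∧-identity = ax-∧E₂ p⊤ pA , closed (⇒-intro (∧I (theorem (ax-EFQ p⊥)) #0))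

⇒-distribˡ-∧ : (pA p⇒ (pB p∧ pC)) ⇔ᵢ ((pA p⇒ pB) p∧ (pA p⇒ pC))
⇒-distribˡ-∧ = closed (⇒-intro (∧I (⇒-intro (∧E₁ (#1 · #0))) (⇒-intro (∧E₂ (#1 · #0)))))
             , closed (⇒-intro (⇒-intro (∧I (∧E₁ #1 · #0) (∧E₂ #1 · #0))))

∨-⇒-distrib : ((pA p∨ pB) p⇒ pC) ⇔ᵢ ((pA p⇒ pC) p∧ (pB p⇒ pC))
∨-⇒-distrib = closed (⇒-intro (∧I (⇒-intro (#1 · ∨I₁ #0)) (⇒-intro (#1 · ∨I₂ #0))))
            , closed (⇒-intro (⇒-intro (∨E (∧E₁ #1) (∧E₂ #1) #0)))

curry : ((pA p∧ pB) p⇒ pC) ⇔ᵢ (pA p⇒ (pB p⇒ pC))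
curry = closed (⇒-intro (⇒-intro (⇒-intro (#2 · ∧I #1 #0))))
      , closed (⇒-intro (⇒-intro (#1 · ∧E₁ #0 · ∧E₂ #0)))

-- Derivations in L

⊤' : Fm
⊤' = ⊥' ⇒ ⊥'

σ₃ : Fm → Fm → Fm → ℕ → Fm
σ₃ a b c 0 = a
σ₃ a b c 1 = b
σ₃ a b c _ = c

fresh : Fm → ℕ
fresh (var y)  = suc y
fresh ⊥'       = 0
fresh (a ⇒ b)  = fresh a ⊔ fresh b
fresh (a ∨' b) = fresh a ⊔ fresh b
fresh (a ∧' b) = fresh a ⊔ fresh b
fresh (□ a)    = fresh a

[≔]-fresh : ∀ χ {n} a → fresh χ ≤ n → χ [ n ≔ a ] ≡ χ
[≔]-fresh (var y) {n} a le with y ≟ n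
... | yes refl = ⊥-elim (n≮n n le)
... | no _     = refl
[≔]-fresh ⊥'       a le = refl
[≔]-fresh (χ ⇒ ψ)  a le = cong₂ _⇒_ ([≔]-fresh χ a (m⊔n≤o⇒m≤o _ _ le)) ([≔]-fresh ψ a (m⊔n≤o⇒n≤o _ _ le))
[≔]-fresh (χ ∨' ψ) a le = cong₂ _∨'_ ([≔]-fresh χ a (m⊔n≤o⇒m≤o _ _ le)) ([≔]-fresh ψ a (m⊔n≤o⇒n≤o _ _ le))
[≔]-fresh (χ ∧' ψ) a le = cong₂ _∧'_ ([≔]-fresh χ a (m⊔n≤o⇒m≤o _ _ le)) ([≔]-fresh ψ a (m⊔n≤o⇒n≤o _ _ le))
[≔]-fresh (□ χ)    a le = cong □ ([≔]-fresh χ a le)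

var-[≔] : ∀ x a → var x [ x ≔ a ] ≡ a
var-[≔] x a with x ≟ x
... | yes _ = refl
... | no x≢x = ⊥-elim (x≢x refl)

module _ {Δ : Fm → Set} where
  ⊢-∧I : ∀ {a b} → Δ ⊢ a → Δ ⊢ b → Δ ⊢ (a ∧' b)
  ⊢-∧I {a} {b} p q = mp (mp (ax (ax-int (σ₃ a b a) _ (ax-∧I pA pB))) p) q

  ⊢-∧E₁ : ∀ {a b} → Δ ⊢ (a ∧' b) → Δ ⊢ a
  ⊢-∧E₁ {a} {b} = mp (ax (ax-int (σ₃ a b a) _ (ax-∧E₁ pA pB)))

  ⊢-∧E₂ : ∀ {a b} → Δ ⊢ (a ∧' b) → Δ ⊢ b
  ⊢-∧E₂ {a} {b} = mp (ax (ax-int (σ₃ a b a) _ (ax-∧E₂ pA pB)))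

  □-trans : ∀ {a b c} → Δ ⊢ □ (a ⇒ b) → Δ ⊢ □ (b ⇒ c) → Δ ⊢ □ (a ⇒ c)
  □-trans {a} {b} {c} p q = mp (mp (ax (ax-tr a b c)) p) q

  □-cong : ∀ {a b} → Δ ⊢ (a ≡' b) → Δ ⊢ (□ a ≡' □ b)
  □-cong {a} {b} = mp (subst-thm a b (□ (var 0)) 0)

  □-resp-≡' : ∀ {a b} → Δ ⊢ (a ≡' b) → Δ ⊢ □ a → Δ ⊢ □ b
  □-resp-≡' e = mp (mp (ax (ax-T _)) (⊢-∧E₁ (□-cong e)))

  ipc-nec : ∀ σ {A} → IPC A → Δ ⊢ □ (inst σ A)
  ipc-nec σ p = nec (ax-int σ _ p)

  □-resp-⇔ᵢ : ∀ σ {A B} → A ⇔ᵢ B → Δ ⊢ □ (inst σ A) → Δ ⊢ □ (inst σ B)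
  □-resp-⇔ᵢ σ (A⇒B , B⇒A) = □-resp-≡' (⊢-∧I (ipc-nec σ A⇒B) (ipc-nec σ B⇒A))

  ⊢-≡'-refl : ∀ {a} → Δ ⊢ (a ≡' a)
  ⊢-≡'-refl {a} = ⊢-∧I (ipc-nec (σ₃ a a a) (ipc-id pA)) (ipc-nec (σ₃ a a a) (ipc-id pA))

  □-⊤⇒ : ∀ {a} → Δ ⊢ □ a → Δ ⊢ □ (⊤' ⇒ a)
  □-⊤⇒ {a} = □-resp-⇔ᵢ (σ₃ a a a) (swap ⊤⇒-identity)

  □-⊤⇒⁻ : ∀ {a} → Δ ⊢ □ (⊤' ⇒ a) → Δ ⊢ □ a
  □-⊤⇒⁻ {a} = □-resp-⇔ᵢ (σ₃ a a a) ⊤⇒-identity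

  -- □ a makes a ≡ ⊤ provable; substituting into x ∧ b (x fresh) turns □(⊤ ∧ b) into □(a ∧ b).
  □-∧ : ∀ {a b} → Δ ⊢ □ a → Δ ⊢ □ b → Δ ⊢ □ (a ∧' b)
  □-∧ {a} {b} □a □b = □-resp-≡' ⊤∧b≡a∧b (□-resp-⇔ᵢ (σ₃ b b b) (swap ⊤∧-identity) □b)
    where
    x = fresh b

    x∧b[x≔_] : ∀ c → (var x ∧' b) [ x ≔ c ] ≡ (c ∧' b)
    x∧b[x≔ c ] = cong₂ _∧'_ (var-[≔] x c) ([≔]-fresh b c ≤-refl)

    ⊤≡a : Δ ⊢ (⊤' ≡' a)
    ⊤≡a = ⊢-∧I (□-⊤⇒ □a) (ipc-nec (σ₃ a a a) ⊤-intro)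

    ⊤∧b≡a∧b : Δ ⊢ ((⊤' ∧' b) ≡' (a ∧' b))
    ⊤∧b≡a∧b = subst₂ (λ u v → Δ ⊢ (u ≡' v)) x∧b[x≔ ⊤' ] x∧b[x≔ a ]
                     (mp (subst-thm ⊤' a (var x ∧' b) x) ⊤≡a)

  □-glb : ∀ {a b c} → Δ ⊢ □ (a ⇒ b) → Δ ⊢ □ (a ⇒ c) → Δ ⊢ □ (a ⇒ (b ∧' c))
  □-glb {a} {b} {c} p q = □-resp-⇔ᵢ (σ₃ a b c) (swap ⇒-distribˡ-∧) (□-∧ p q)

  □-lub : ∀ {a b c} → Δ ⊢ □ (a ⇒ c) → Δ ⊢ □ (b ⇒ c) → Δ ⊢ □ ((a ∨' b) ⇒ c)
  □-lub {a} {b} {c} p q = □-resp-⇔ᵢ (σ₃ a b c) (swap ∨-⇒-distrib) (□-∧ p q)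

  □-curry : ∀ {a b c} → Δ ⊢ □ ((a ∧' b) ⇒ c) → Δ ⊢ □ (a ⇒ (b ⇒ c))
  □-curry {a} {b} {c} = □-resp-⇔ᵢ (σ₃ a b c) curry

  □-uncurry : ∀ {a b c} → Δ ⊢ □ (a ⇒ (b ⇒ c)) → Δ ⊢ □ ((a ∧' b) ⇒ c)
  □-uncurry {a} {b} {c} = □-resp-⇔ᵢ (σ₃ a b c) (swap curry)

⊢-mono : ∀ {Δ Δ'} → Δ ⊆ Δ' → ∀ {φ} → Δ ⊢ φ → Δ' ⊢ φ
⊢-mono Δ⊆Δ' (hyp φ∈Δ)           = hyp (Δ⊆Δ' φ∈Δ)
⊢-mono Δ⊆Δ' (ax a)              = ax a
⊢-mono Δ⊆Δ' (nec a)             = nec a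
⊢-mono Δ⊆Δ' (tnd φ)             = tnd φ
⊢-mono Δ⊆Δ' (subst-thm φ ψ χ x) = subst-thm φ ψ χ x
⊢-mono Δ⊆Δ' (mp p q)            = mp (⊢-mono Δ⊆Δ' p) (⊢-mono Δ⊆Δ' q)

deduction : ∀ {Δ φ ψ} → (Δ ∪ ｛ φ ｝) ⊢ ψ → Δ ⊢ (φ ⇒ ψ)
deduction {Δ} {φ} d = go d
  where
  K : ∀ {a} → Δ ⊢ a → Δ ⊢ (φ ⇒ a)
  K {a} = mp (ax (ax-int (σ₃ a φ a) _ (ax-K pA pB)))

  go : ∀ {ψ} → (Δ ∪ ｛ φ ｝) ⊢ ψ → Δ ⊢ (φ ⇒ ψ)
  go (hyp (inj₁ ψ∈Δ))      = K (hyp ψ∈Δ)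
  go (hyp (inj₂ refl))     = ax (ax-int (σ₃ φ φ φ) _ (ipc-id pA))
  go (ax a)                = K (ax a)
  go (nec a)               = K (nec a)
  go (tnd χ)               = K (tnd χ)
  go (subst-thm χ₁ χ₂ χ x) = K (subst-thm χ₁ χ₂ χ x)
  go (mp {a} {b} p q)      = mp (mp (ax (ax-int (σ₃ φ a b) _ (ax-S pA pB pC))) (go p)) (go q)

-- Compactness

module _ (G : ℕ → Fm → Set) (G-step : ∀ n → G n ⊆ G (suc n)) where
  chain-mono : ∀ {m n} → m ≤ n → G m ⊆ G n
  chain-mono m≤n = go (≤⇒≤′ m≤n)
    where
    go : ∀ {m n} → m ≤′ n → G m ⊆ G n
    go (≤′-reflexive refl) = λ x → x
    go (≤′-step m≤′n)      = λ x → G-step _ (go m≤′n x)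

  ⋃-compact : ∀ {ψ} → ⋃ ℕ G ⊢ ψ → Σ ℕ λ n → G n ⊢ ψ
  ⋃-compact (hyp (n , ψ∈Gn))      = n , hyp ψ∈Gn
  ⋃-compact (ax a)                = 0 , ax a
  ⋃-compact (nec a)               = 0 , nec a
  ⋃-compact (tnd φ)               = 0 , tnd φ
  ⋃-compact (subst-thm φ ψ χ x)   = 0 , subst-thm φ ψ χ x
  ⋃-compact (mp p q) with ⋃-compact p | ⋃-compact q
  ... | m , p′ | n , q′ =
    m ⊔ n , mp (⊢-mono (chain-mono (m≤m⊔n m n)) p′) (⊢-mono (chain-mono (m≤n⊔m m n)) q′)

-- Formulas are written in reverse Polish notation as a binary numeral, least significant bit
-- first, each symbol k as k one-bits followed by a zero-bit; reading the numeral back with a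
-- stack machine recovers the formula.
emit : ℕ → ℕᵇ → ℕᵇ
emit zero    r = 1+[2 r ]
emit (suc k) r = 2[1+ emit k r ]

serialise : Fm → ℕᵇ → ℕᵇ
serialise (var n)  r = emit (5 + n) r
serialise ⊥'       r = emit 0 r
serialise (a ⇒ b)  r = serialise a (serialise b (emit 1 r))
serialise (a ∨' b) r = serialise a (serialise b (emit 2 r))
serialise (a ∧' b) r = serialise a (serialise b (emit 3 r))
serialise (□ a)    r = serialise a (emit 4 r)

push : ℕ → List Fm → List Fm
push 0 st           = ⊥' ∷ st
push 1 (b ∷ a ∷ st) = (a ⇒ b) ∷ st
push 2 (b ∷ a ∷ st) = (a ∨' b) ∷ st
push 3 (b ∷ a ∷ st) = (a ∧' b) ∷ st
push 4 (a ∷ st)     = □ a ∷ st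
push (suc (suc (suc (suc (suc n))))) st = var n ∷ st
push _ st           = st

read : ℕ → List Fm → ℕᵇ → List Fm
read k st zero      = st
read k st 2[1+ r ]  = read (suc k) st r
read k st 1+[2 r ]  = read 0 (push k st) r

read-emit : ∀ k j st r → read k st (emit j r) ≡ read 0 (push (k + j) st) r
read-emit k zero    st r rewrite +-identityʳ k = refl
read-emit k (suc j) st r rewrite +-suc k j = read-emit (suc k) j st r

read-serialise : ∀ φ st r → read 0 st (serialise φ r) ≡ read 0 (φ ∷ st) r
read-serialise (var n)  st r = read-emit 0 (5 + n) st r
read-serialise ⊥'       st r = read-emit 0 0 st r
read-serialise (a ⇒ b)  st r =
  trans (read-serialise a _ _) (trans (read-serialise b _ _) (read-emit 0 1 (b ∷ a ∷ st) r))
read-serialise (a ∨' b) st r =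
  trans (read-serialise a _ _) (trans (read-serialise b _ _) (read-emit 0 2 (b ∷ a ∷ st) r))
read-serialise (a ∧' b) st r =
  trans (read-serialise a _ _) (trans (read-serialise b _ _) (read-emit 0 3 (b ∷ a ∷ st) r))
read-serialise (□ a)    st r = trans (read-serialise a _ _) (read-emit 0 4 (a ∷ st) r)

encode : Fm → ℕ
encode φ = toℕ (serialise φ zero)

encode-injective : ∀ {a b} → encode a ≡ encode b → a ≡ b
encode-injective {a} {b} e = ∷-injectiveˡ (begin
  a ∷ []                       ≡⟨ sym (read-serialise a [] zero) ⟩
  read 0 [] (serialise a zero) ≡⟨ cong (read 0 []) (toℕ-injective {serialise a zero} {serialise b zero} e) ⟩
  read 0 [] (serialise b zero) ≡⟨ read-serialise b [] zero ⟩
  b ∷ []                       ∎)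
  where open ≡-Reasoning

-- Lindenbaum's lemma

Complete : (Fm → Set) → Set
Complete Γ = ∀ φ → Γ ⊢ φ ⊎ Γ ⊢ ¬' φ

module Lindenbaum (em : ExcludedMiddle 0ℓ) (Ψ : Fm → Set) (Ψ-consistent : L-consistent Ψ) where
  stage : ℕ → Fm → Set
  stage zero    = Ψ
  stage (suc n) = stage n ∪ λ χ → encode χ ≡ n × L-consistent (stage n ∪ ｛ χ ｝)

  stage-consistent : ∀ n → L-consistent (stage n)
  stage-consistent zero = Ψ-consistent
  stage-consistent (suc n) ⊢⊥
    with em {Σ Fm λ χ → encode χ ≡ n × L-consistent (stage n ∪ ｛ χ ｝)}
  ... | no ∄χ = stage-consistent n (⊢-mono nothing-added ⊢⊥)
    where
    nothing-added : stage (suc n) ⊆ stage n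
    nothing-added (inj₁ χ∈stage) = χ∈stage
    nothing-added (inj₂ (e , c)) = ⊥-elim (∄χ (_ , e , c))
  ... | yes (χ₀ , e₀ , χ₀-consistent) = χ₀-consistent (⊢-mono only-χ₀-added ⊢⊥)
    where
    only-χ₀-added : stage (suc n) ⊆ (stage n ∪ ｛ χ₀ ｝)
    only-χ₀-added (inj₁ χ∈stage) = inj₁ χ∈stage
    only-χ₀-added (inj₂ (e , _)) = inj₂ (encode-injective (trans e₀ (sym e)))

  Γ : Fm → Set
  Γ = ⋃ ℕ stage

  stage⊆Γ : ∀ n → stage n ⊆ Γ
  stage⊆Γ n χ∈stage = n , χ∈stage

  Γ-consistent : L-consistent Γ
  Γ-consistent ⊢⊥ with ⋃-compact stage (λ _ → inj₁) ⊢⊥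
  ... | n , stage⊢⊥ = stage-consistent n stage⊢⊥

  Γ-complete : Complete Γ
  Γ-complete φ with em {(stage (encode φ) ∪ ｛ φ ｝) ⊢ ⊥'}
  ... | yes ⊢⊥ = inj₂ (⊢-mono (stage⊆Γ (encode φ)) (deduction ⊢⊥))
  ... | no  φ-consistent = inj₁ (hyp (suc (encode φ) , inj₂ (refl , φ-consistent)))

lindenbaum : ExcludedMiddle 0ℓ → ∀ Ψ → L-consistent Ψ →
             Σ (Fm → Set) λ Γ → Ψ ⊆ Γ × L-consistent Γ × Complete Γ
lindenbaum em Ψ Ψ-consistent = Γ , stage⊆Γ 0 , Γ-consistent , Γ-complete
  where open Lindenbaum em Ψ Ψ-consistent

-- The canonical model

lindenbaumAlgebra : (Fm → Set) → HeytingAlgebra 0ℓ 0ℓ 0ℓ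
lindenbaumAlgebra Δ = record
  { Carrier = Fm
  ; _≈_     = λ a b → Δ ⊢ (a ≡' b)
  ; _≤_     = λ a b → Δ ⊢ □ (a ⇒ b)
  ; _∨_     = _∨'_
  ; _∧_     = _∧'_
  ; _⇨_     = _⇒_
  ; ⊤       = ⊤'
  ; ⊥       = ⊥'
  ; isHeytingAlgebra = record
    { isBoundedLattice = record
      { isLattice = record
        { isPartialOrder = record
          { isPreorder = record
            { isEquivalence = record
              { refl  = ⊢-≡'-refl
              ; sym   = λ e → ⊢-∧I (⊢-∧E₂ e) (⊢-∧E₁ e)
              ; trans = λ e f → ⊢-∧I (□-trans (⊢-∧E₁ e) (⊢-∧E₁ f)) (□-trans (⊢-∧E₂ f) (⊢-∧E₂ e))
              }
            ; reflexive = ⊢-∧E₁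
            ; trans     = □-trans
            }
          ; antisym = ⊢-∧I
          }
        ; supremum = λ a b → ipc-nec (σ₃ a b a) (ax-∨I₁ pA pB) , ipc-nec (σ₃ a b a) (ax-∨I₂ pA pB)
                           , λ _ → □-lub
        ; infimum  = λ a b → ipc-nec (σ₃ a b a) (ax-∧E₁ pA pB) , ipc-nec (σ₃ a b a) (ax-∧E₂ pA pB)
                           , λ _ → □-glb
        }
      ; maximum = λ a → ipc-nec (σ₃ a a a) ⊤-intro
      ; minimum = λ a → ipc-nec (σ₃ a a a) (ax-EFQ pA)
      }
    ; exponential = λ _ _ _ → □-curry , □-uncurry
    }
  }

module _ {Γ : Fm → Set} (Γ-consistent : L-consistent Γ) (Γ-complete : Complete Γ) where
  theorems-ultrafilter : IsUltrafilter (lindenbaumAlgebra Γ) (Γ ⊢_)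
  theorems-ultrafilter = record
    { isFilter = theorems-filter
    ; maximal  = maximal
    }
    where
    theorems-filter : IsFilter (lindenbaumAlgebra Γ) (Γ ⊢_)
    theorems-filter = record
      { nonempty = ⊤' , ax (ax-int (σ₃ ⊥' ⊥' ⊥') _ (ipc-id pA))
      ; upward   = λ ⊢m m≤m' → mp (mp (ax (ax-T _)) m≤m') ⊢m
      ; meet     = ⊢-∧I
      ; bot∉     = Γ-consistent
      }

    maximal : ∀ F → IsFilter (lindenbaumAlgebra Γ) F → (Γ ⊢_) ⊆′ F → F ⊆′ (Γ ⊢_)
    maximal F F-filter ⊢⊆F m m∈F with Γ-complete m
    ... | inj₁ ⊢m  = ⊢m
    ... | inj₂ ⊢¬m = ⊥-elim (bot∉ (upward (meet m∈F (⊢⊆F _ ⊢¬m)) (ipc-nec (σ₃ m m m) non-contradiction)))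
      where open IsFilter F-filter

  canonicalModel : Model
  canonicalModel = record
    { HA         = lindenbaumAlgebra Γ
    ; TRUE       = Γ ⊢_
    ; TRUE-ultra = theorems-ultrafilter
    ; f□         = □
    ; f□-cong    = □-cong
    ; cond1      = λ m → nec (ax-T m)
    ; cond2      = λ m m' m'' → nec (ax-tr m m' m'')
    ; cond3      = λ m m' → nec (ax-dis m m')
    ; cond4      = λ m → (λ ⊢□m → ⊢-∧I (ipc-nec (σ₃ m m m) ⊤-intro) (□-⊤⇒ ⊢□m))
                       , (λ m≈⊤ → □-⊤⇒⁻ (⊢-∧E₂ m≈⊤))
    }

  ⟦⟧-var : ∀ φ → ⟦ canonicalModel ⟧ φ var ≡ φ
  ⟦⟧-var (var n)  = refl
  ⟦⟧-var ⊥'       = refl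
  ⟦⟧-var (a ⇒ b)  = cong₂ _⇒_ (⟦⟧-var a) (⟦⟧-var b)
  ⟦⟧-var (a ∨' b) = cong₂ _∨'_ (⟦⟧-var a) (⟦⟧-var b)
  ⟦⟧-var (a ∧' b) = cong₂ _∧'_ (⟦⟧-var a) (⟦⟧-var b)
  ⟦⟧-var (□ a)    = cong □ (⟦⟧-var a)

  canonical-⊨ : ∀ {φ} → Γ ⊢ φ → canonicalModel , var ⊨ φ
  canonical-⊨ {φ} = subst (Γ ⊢_) (sym (⟦⟧-var φ))

lemma4p2 : ExcludedMiddle 0ℓ → (Ψ : Fm → Set) → L-consistent Ψ → Satisfiable Ψ
lemma4p2 em Ψ Ψ-consistent with lindenbaum em Ψ Ψ-consistent
... | Γ , Ψ⊆Γ , Γ-consistent , Γ-complete =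
  canonicalModel Γ-consistent Γ-complete , var , λ ψ ψ∈Ψ → canonical-⊨ Γ-consistent Γ-complete (hyp (Ψ⊆Γ ψ∈Ψ))
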